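{- Let $q$ be a prime power, $n\ge 5$, $\lambda_2=\frac{q^{n-1}-q^3}{q-1}-q-1$, and let $\mathcal L$ be a set of planes of ${\rm PG}(n,q)$ and $x>0$ an integer such that every plane not in $\mathcal L$ meets exactly $x$ planes of $\mathcal L$ in a line and every plane of $\mathcal L$ meets exactly $\lambda_2+x$ other planes of $\mathcal L$ in a line. If some plane of $\mathcal L$ has the property that each of its lines lies in a plane that is not contained in $\mathcal L$, then $x-1\ge (\lambda_2+1)/(q^2+q)$.
   Context: A plane is a 2-dimensional projective subspace of ${\rm PG}(n,q)$. -}

module Defs where

open import Level using (0ℓ)
open import Data.Nat as ℕ using (ℕ; zero; suc; _∸_; _^_)
open import Data.Nat.DivMod using (_/_)
open import Data.Fin using (Fin)
open import Data.Unit using (⊤)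
open import Data.List using (List; length)
open import Data.List.Relation.Unary.All using (All)
open import Data.List.Relation.Unary.Any using (Any)
open import Data.List.Relation.Unary.AllPairs using (AllPairs)
open import Data.Product using (Σ; ∃; _×_; _,_)
open import Relation.Binary.PropositionalEquality using (_≡_)
open import Relation.Nullary using (¬_)
open import Algebra.Bundles using (CommutativeRing)

-- Counting up to an equivalence relation:
-- "exactly k elements (up to ≈) of A satisfy P": a duplicate-free
-- (w.r.t. ≈) list of length k of elements satisfying P that contains
-- (up to ≈) every element satisfying P.

HasSize : {A : Set} → (_≈_ : A → A → Set) → (P : A → Set) → ℕ → Set
HasSize {A} _≈_ P k =
  Σ (List A) λ xs →
    (length xs ≡ k)
    × All P xs
    × AllPairs (λ a b → ¬ (a ≈ b)) xs
    × (∀ y → P y → Any (λ a → y ≈ a) xs)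

record Field : Set₁ where
  field
    commRing : CommutativeRing 0ℓ 0ℓ
  open CommutativeRing commRing public
  field
    1≉0     : ¬ (1# ≈ 0#)
    inverse : ∀ x → ¬ (x ≈ 0#) → ∃ λ y → (x * y) ≈ 1#

-- A field with exactly q elements.  (Such a field exists iff q is a
-- prime power, and it is unique up to isomorphism: it is GF(q).)
record FiniteField (q : ℕ) : Set₁ where
  field
    fld  : Field
  open Field fld public
  field
    size : HasSize _≈_ (λ _ → ⊤) q

-- PG(n, F): subspaces of the vector space F^(n+1).
-- Projective k-dimensional subspaces = (k+1)-dimensional vector subspaces.

module PG (F : Field) (n : ℕ) where
  open Field F

  V : Set
  V = Fin (suc n) → Carrier

  _≈ᵥ_ : V → V → Set
  u ≈ᵥ v = ∀ i → u i ≈ v i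

  0ᵥ : V
  0ᵥ _ = 0#

  _+ᵥ_ : V → V → V
  (u +ᵥ v) i = u i + v i

  _·_ : Carrier → V → V
  (a · v) i = a * v i

  lincomb : {k : ℕ} → (Fin k → Carrier) → (Fin k → V) → V
  lincomb {zero}  c b = 0ᵥ
  lincomb {suc k} c b =
    (c Fin.zero · b Fin.zero) +ᵥ lincomb (λ i → c (Fin.suc i)) (λ i → b (Fin.suc i))

  LinIndep : {k : ℕ} → (Fin k → V) → Set
  LinIndep {k} b = ∀ (c : Fin k → Carrier) → lincomb c b ≈ᵥ 0ᵥ → ∀ i → c i ≈ 0#

  Subspace : Set₁
  Subspace = V → Set

  HasDim : Subspace → ℕ → Set
  HasDim S d =
    (Σ (Fin d → V) λ b → LinIndep b × (∀ i → S (b i)))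
    × ¬ (Σ (Fin (suc d) → V) λ b → LinIndep b × (∀ i → S (b i)))

  record Plane : Set where
    field
      basis : Fin 3 → V
      indep : LinIndep basis

  _∈ₚ_ : V → Plane → Set
  v ∈ₚ π = ∃ λ (c : Fin 3 → Carrier) → v ≈ᵥ lincomb c (Plane.basis π)

  _≅_ : Plane → Plane → Set
  π ≅ σ = ∀ v → (v ∈ₚ π → v ∈ₚ σ) × (v ∈ₚ σ → v ∈ₚ π)

  MeetInLine : Plane → Plane → Set
  MeetInLine π σ = HasDim (λ v → v ∈ₚ π × v ∈ₚ σ) 2

  IsPlaneSet : (Plane → Set) → Set
  IsPlaneSet L = ∀ π σ → π ≅ σ → L π → L σ

  record Line : Set where
    field
      basis : Fin 2 → V
      indep : LinIndep basis

  _⊆ₗ_ : Line → Plane → Set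
  l ⊆ₗ π = ∀ i → Line.basis l i ∈ₚ π

-- λ₂ = (q^(n-1) - q^3)/(q-1) - q - 1   (an integer, positive for n ≥ 5, q ≥ 2)

λ₂ : (q n : ℕ) → .{{_ : ℕ.NonZero (q ∸ 1)}} → ℕ
λ₂ q n = (q ^ (n ∸ 1) ∸ q ^ 3) / (q ∸ 1) ∸ q ∸ 1

-- A plane π of L all of whose lines lie in planes outside L has at most
-- (q² + q + 1)(x − 1) neighbours in L (planes of L meeting it in a line):
-- choose for every line l of π a plane σ_l ∉ L through l.  A neighbour τ of π
-- contains the line l = π ∩ τ, so it meets σ_l in a line and is one of the x
-- planes of L doing so, but not π itself.  Since π has λ₂ + x neighbours,
-- λ₂ + x ≤ (q² + q + 1)(x − 1), which rearranges to the claim.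
--
-- The lines of π are enumerated as the kernels, in coordinates with respect to
-- a basis of π, of the q² + q + 1 normalised nonzero linear forms on F³; the
-- form vanishing on a given line is the normalised cross product of two of its
-- vectors.

module Submission where

open import Defs
open import Algebra.Bundles using (CommutativeRing)
open import Data.Empty using (⊥-elim)
open import Data.Fin using (Fin; zero; suc)
open import Data.Integer as ℤ using (ℤ; +_; -[1+_]; _⊖_)
import Data.Integer.Properties as ℤ
open import Data.List using (List; []; _∷_; [_]; _++_; length; map; concatMap; deduplicate; cartesianProductWith)
open import Data.List.Properties using (length-removeAt′; length-map; length-++)
open import Data.List.Relation.Unary.All as All using (All; _∷_)
import Data.List.Relation.Unary.All.Properties as Allₚ
open import Data.List.Relation.Unary.All.Properties.Core using (¬Any⇒All¬)
open import Data.List.Relation.Unary.AllPairs as AllPairs using (AllPairs; _∷_)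
open import Data.List.Relation.Unary.Any as Any using (Any; here; there)
import Data.List.Relation.Unary.Any.Properties as Anyₚ
import Data.Maybe as Maybe
open import Data.Nat as ℕ using (ℕ; zero; suc; _∸_; _≤_; z≤n; s≤s)
open import Data.Nat.Properties using (≤-trans; ≤-reflexive; <-irrefl; module ≤-Reasoning)
open import Data.Product using (∃; _×_; _,_; proj₁; proj₂; swap)
open import Data.Unit using (tt)
open import Data.Vec.Functional as Vec using (Vector)
open import Function using (_∘_; id)
open import Level using (Level)
open import Relation.Binary.Bundles using (Setoid; DecSetoid)
open import Relation.Binary.PropositionalEquality as ≡ using (_≡_)
open import Relation.Nullary using (¬_; Dec; yes; no)
open import Relation.Nullary.Decidable using (dec⇒maybe)

-- Integer coefficients let the solver normalise 0#, 1# and -_ in an arbitrary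
-- commutative ring (the reflective Tactic.RingSolver treats constants as opaque).
-- With the optimised multiple _×′_, the constants :0 and :1 denote 0# and 1#
-- definitionally.
module ℤ-CoefficientRingSolver {c ℓ : Level} (R : CommutativeRing c ℓ) where
  open CommutativeRing R
  open import Algebra.Properties.Ring ring using (-‿+-comm; -‿involutive; -0#≈0#; -‿distribˡ-*; -‿distribʳ-*)
  open import Algebra.Properties.CommutativeSemigroup +-commutativeSemigroup using (x∙yz≈y∙xz)
  open import Algebra.Properties.Semiring.Mult.TCOptimised semiring using (1+×; ×-homo-+; ×1-homo-*) renaming (_×_ to _×′_)
  open import Algebra.Solver.Ring.AlmostCommutativeRing
    using (fromCommutativeRing; _-Raw-AlmostCommutative⟶_)
  open import Relation.Binary.Reasoning.Setoid setoid

  ℤ⟦_⟧ : ℤ → Carrier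
  ℤ⟦ + n ⟧    = n ×′ 1#
  ℤ⟦ -[1+ n ] ⟧ = - (suc n ×′ 1#)

  ℤ⟦⟧-cong : ∀ {i j} → i ≡ j → ℤ⟦ i ⟧ ≈ ℤ⟦ j ⟧
  ℤ⟦⟧-cong ≡.refl = refl

  ⊖-homo : ∀ m n → ℤ⟦ m ⊖ n ⟧ + n ×′ 1# ≈ m ×′ 1#
  ⊖-homo m       zero    = +-identityʳ _
  ⊖-homo zero    (suc n) = -‿inverseˡ _
  ⊖-homo (suc m) (suc n) = begin
    ℤ⟦ suc m ⊖ suc n ⟧ + suc n ×′ 1#    ≈⟨ +-cong (ℤ⟦⟧-cong (ℤ.[1+m]⊖[1+n]≡m⊖n m n)) (1+× n 1#) ⟩
    ℤ⟦ m ⊖ n ⟧ + (1# + n ×′ 1#)         ≈⟨ x∙yz≈y∙xz _ _ _ ⟩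
    1# + (ℤ⟦ m ⊖ n ⟧ + n ×′ 1#)         ≈⟨ +-congˡ (⊖-homo m n) ⟩
    1# + m ×′ 1#                        ≈⟨ 1+× m 1# ⟨
    suc m ×′ 1#                         ∎

  ⊖-homo′ : ∀ m n → ℤ⟦ m ⊖ n ⟧ ≈ m ×′ 1# - n ×′ 1#
  ⊖-homo′ m n = begin
    ℤ⟦ m ⊖ n ⟧                        ≈⟨ +-identityʳ _ ⟨
    ℤ⟦ m ⊖ n ⟧ + 0#                   ≈⟨ +-congˡ (-‿inverseʳ _) ⟨
    ℤ⟦ m ⊖ n ⟧ + (n ×′ 1# - n ×′ 1#)    ≈⟨ +-assoc _ _ _ ⟨
    (ℤ⟦ m ⊖ n ⟧ + n ×′ 1#) - n ×′ 1#    ≈⟨ +-congʳ (⊖-homo m n) ⟩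
    m ×′ 1# - n ×′ 1#                  ∎

  neg-homo : ∀ i → ℤ⟦ ℤ.- i ⟧ ≈ - ℤ⟦ i ⟧
  neg-homo (+ zero)  = sym -0#≈0#
  neg-homo (+ suc n) = refl
  neg-homo -[1+ n ]  = sym (-‿involutive _)

  +-homo : ∀ i j → ℤ⟦ i ℤ.+ j ⟧ ≈ ℤ⟦ i ⟧ + ℤ⟦ j ⟧
  +-homo (+ m)    (+ n)    = ×-homo-+ 1# m n
  +-homo (+ m)    -[1+ n ] = ⊖-homo′ m (suc n)
  +-homo -[1+ m ] (+ n)    = trans (⊖-homo′ n (suc m)) (+-comm _ _)
  +-homo -[1+ m ] -[1+ n ] = begin
    - (suc (suc (m ℕ.+ n)) ×′ 1#)       ≈⟨ -‿cong (ℤ⟦⟧-cong {+ _} (≡.cong (λ k → + suc k) (≡.sym (ℕ.+-suc m n)))) ⟩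
    - ((suc m ℕ.+ suc n) ×′ 1#)         ≈⟨ -‿cong (×-homo-+ 1# (suc m) (suc n)) ⟩
    - (suc m ×′ 1# + suc n ×′ 1#)        ≈⟨ -‿+-comm _ _ ⟨
    - (suc m ×′ 1#) + - (suc n ×′ 1#)    ∎
    where import Data.Nat.Properties as ℕ

  *-homo⁺ : ∀ m j → ℤ⟦ + m ℤ.* j ⟧ ≈ m ×′ 1# * ℤ⟦ j ⟧
  *-homo⁺ m (+ n)    = trans (ℤ⟦⟧-cong (≡.sym (ℤ.pos-* m n))) (×1-homo-* m n)
  *-homo⁺ m -[1+ n ] = begin
    ℤ⟦ + m ℤ.* ℤ.- (+ suc n) ⟧      ≈⟨ ℤ⟦⟧-cong (ℤ.neg-distribʳ-* (+ m) (+ suc n)) ⟨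
    ℤ⟦ ℤ.- (+ m ℤ.* + suc n) ⟧      ≈⟨ neg-homo (+ m ℤ.* + suc n) ⟩
    - ℤ⟦ + m ℤ.* + suc n ⟧          ≈⟨ -‿cong (*-homo⁺ m (+ suc n)) ⟩
    - (m ×′ 1# * (suc n ×′ 1#))      ≈⟨ -‿distribʳ-* _ _ ⟩
    m ×′ 1# * - (suc n ×′ 1#)        ∎

  *-homo : ∀ i j → ℤ⟦ i ℤ.* j ⟧ ≈ ℤ⟦ i ⟧ * ℤ⟦ j ⟧
  *-homo (+ m)    j = *-homo⁺ m j
  *-homo -[1+ m ] j = begin
    ℤ⟦ ℤ.- (+ suc m) ℤ.* j ⟧      ≈⟨ ℤ⟦⟧-cong (ℤ.neg-distribˡ-* (+ suc m) j) ⟨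
    ℤ⟦ ℤ.- (+ suc m ℤ.* j) ⟧      ≈⟨ neg-homo (+ suc m ℤ.* j) ⟩
    - ℤ⟦ + suc m ℤ.* j ⟧          ≈⟨ -‿cong (*-homo⁺ (suc m) j) ⟩
    - (suc m ×′ 1# * ℤ⟦ j ⟧)       ≈⟨ -‿distribˡ-* _ _ ⟩
    - (suc m ×′ 1#) * ℤ⟦ j ⟧       ∎

  ℤ-homomorphism : ℤ.+-*-rawRing -Raw-AlmostCommutative⟶ fromCommutativeRing R
  ℤ-homomorphism = record
    { ⟦_⟧ = ℤ⟦_⟧ ; +-homo = +-homo ; *-homo = *-homo ; -‿homo = neg-homo
    ; 0-homo = refl ; 1-homo = refl }

  open import Algebra.Solver.Ring ℤ.+-*-rawRing (fromCommutativeRing R) ℤ-homomorphism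
    (λ i j → Maybe.map ℤ⟦⟧-cong (dec⇒maybe (i ℤ.≟ j))) public

  :0 :1 : ∀ {m} → Polynomial m
  :0 = con (+ 0)
  :1 = con (+ 1)

length-concatMap : ∀ {a b} {A : Set a} {B : Set b} {k} (f : A → List B) →
  (∀ x → length (f x) ≡ k) → ∀ xs → length (concatMap f xs) ≡ length xs ℕ.* k
length-concatMap f f-length []       = ≡.refl
length-concatMap f f-length (x ∷ xs) =
  ≡.trans (length-++ (f x)) (≡.cong₂ ℕ._+_ (f-length x) (length-concatMap f f-length xs))

module FiniteSetoid {a ℓ : Level} (S : Setoid a ℓ) where
  open Setoid S renaming (Carrier to A)
  open import Data.List.Membership.Setoid S using (_∈_; _─_)
  open import Data.List.Membership.Setoid.Properties using (∈-resp-≈)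
  open import Data.List.Relation.Unary.Unique.Setoid S using (Unique)
  open import Data.List.Relation.Unary.Unique.Setoid.Properties using (Unique[x∷xs]⇒x∉xs)

  ∈-─ : ∀ {x y ys} (y∈ys : y ∈ ys) → x ∈ ys → ¬ x ≈ y → x ∈ ys ─ y∈ys
  ∈-─ (here y≈z) (here x≈z) x≉y = ⊥-elim (x≉y (trans x≈z (sym y≈z)))
  ∈-─ (here _)   (there x∈) _   = x∈
  ∈-─ (there _)  (here x≈z) _   = here x≈z
  ∈-─ (there y∈) (there x∈) x≉y = there (∈-─ y∈ x∈ x≉y)

  Unique⇒length≤ : ∀ {xs ys} → Unique xs → All (_∈ ys) xs → length xs ≤ length ys
  Unique⇒length≤ {[]}     _             _              = z≤n
  Unique⇒length≤ {x ∷ xs} {ys} (x≉xs ∷ xs!) (x∈ys ∷ xs⊆ys) =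
    ≤-trans (s≤s (Unique⇒length≤ xs! (All.zipWith xs⊆ys─x (xs⊆ys , x≉xs))))
            (≤-reflexive (≡.sym (length-removeAt′ ys _)))
    where
    xs⊆ys─x : ∀ {z} → z ∈ ys × ¬ x ≈ z → z ∈ ys ─ x∈ys
    xs⊆ys─x {z} (z∈ys , x≉z) = ∈-─ {x = z} {y = x} x∈ys z∈ys (x≉z ∘ sym)

  ≈-dec : ∀ {xs} → Unique xs → ∀ {x y} → x ∈ xs → y ∈ xs → Dec (x ≈ y)
  ≈-dec _ (here x≈z) (here y≈z) = yes (trans x≈z (sym y≈z))
  ≈-dec u (here x≈z) (there y∈) =
    no λ x≈y → Unique[x∷xs]⇒x∉xs S u (∈-resp-≈ S (trans (sym x≈y) x≈z) y∈)
  ≈-dec u (there x∈) (here y≈z) =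
    no λ x≈y → Unique[x∷xs]⇒x∉xs S u (∈-resp-≈ S (trans x≈y y≈z) x∈)
  ≈-dec u (there x∈) (there y∈) = ≈-dec (AllPairs.tail u) x∈ y∈

module FiniteDecSetoid {a ℓ : Level} (S : DecSetoid a ℓ) where
  open DecSetoid S renaming (Carrier to A)
  open import Data.List.Relation.Unary.Enumerates.Setoid setoid using (IsEnumeration)
  open import Data.List.Relation.Unary.Enumerates.Setoid.Properties using (deduplicate⁺)
  open import Data.List.Relation.Unary.Unique.DecSetoid.Properties using (deduplicate-!)
  import Data.List.Relation.Unary.Unique.Setoid.Properties as Unique
  open FiniteSetoid setoid using (Unique⇒length≤)

  injective⇒surjective : ∀ {xs} → IsEnumeration xs → (f : A → A) →
    (∀ {x y} → f x ≈ f y → x ≈ y) → ∀ y → ∃ λ x → y ≈ f x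
  injective⇒surjective {xs} xs-enum f f-inj y with Any.any? (λ x → y ≟ f x) (deduplicate _≟_ xs)
  ... | yes y∈f[ys] = Any.satisfied y∈f[ys]
  ... | no  y∉f[ys] = ⊥-elim (<-irrefl ≡.refl (begin-strict
      length ys               ≡⟨ length-map f ys ⟨
      length (map f ys)       <⟨ Unique⇒length≤ y∷f[ys]! (All.universal ys-enum _) ⟩
      length ys               ∎))
    where
    ys = deduplicate _≟_ xs
    ys-enum : IsEnumeration ys
    ys-enum = deduplicate⁺ S xs-enum
    y∷f[ys]! = Allₚ.map⁺ (¬Any⇒All¬ ys y∉f[ys]) ∷ Unique.map⁺ setoid setoid f-inj (deduplicate-! S xs)
    open ≤-Reasoning

module VectorEnumeration {a ℓ : Level} (S : Setoid a ℓ) where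
  open Setoid S renaming (Carrier to A)
  open import Data.Vec.Functional.Relation.Binary.Equality.Setoid S using (≋-setoid)
  open import Data.List.Relation.Unary.Enumerates.Setoid using (IsEnumeration)

  vectors : List A → ∀ d → List (Vector A d)
  vectors xs zero    = [ Vec.[] ]
  vectors xs (suc d) = cartesianProductWith Vec._∷_ xs (vectors xs d)

  vectors-enumerates : ∀ {xs} → IsEnumeration S xs → ∀ d → IsEnumeration (≋-setoid d) (vectors xs d)
  vectors-enumerates xs-enum zero    v = here λ ()
  vectors-enumerates xs-enum (suc d) v =
    Anyₚ.cartesianProductWith⁺ Vec._∷_ (λ v₀≈x v′≋w → λ { zero → v₀≈x ; (suc i) → v′≋w i })
      (xs-enum (Vec.head v)) (vectors-enumerates xs-enum d (Vec.tail v))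

module DotProduct (F : Field) where
  open Field F hiding (zero)
  open ℤ-CoefficientRingSolver commRing using (solve; _:+_; _:*_; _:=_)

  infix 7 ⟨_,_⟩
  ⟨_,_⟩ : ∀ {k} → (Fin k → Carrier) → (Fin k → Carrier) → Carrier
  ⟨_,_⟩ {zero}  f v = 0#
  ⟨_,_⟩ {suc k} f v = f zero * v zero + ⟨ Vec.tail f , Vec.tail v ⟩

  ⟨⟩-congˡ : ∀ {k} {f f′ : Fin k → Carrier} (v : Fin k → Carrier) →
    (∀ i → f i ≈ f′ i) → ⟨ f , v ⟩ ≈ ⟨ f′ , v ⟩
  ⟨⟩-congˡ {zero}  _ _  = refl
  ⟨⟩-congˡ {suc k} v f≈ = +-cong (*-congʳ (f≈ zero)) (⟨⟩-congˡ (Vec.tail v) (f≈ ∘ suc))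

  ⟨⟩-congʳ : ∀ {k} (f : Fin k → Carrier) {v v′ : Fin k → Carrier} →
    (∀ i → v i ≈ v′ i) → ⟨ f , v ⟩ ≈ ⟨ f , v′ ⟩
  ⟨⟩-congʳ {zero}  _ _  = refl
  ⟨⟩-congʳ {suc k} f v≈ = +-cong (*-congˡ (v≈ zero)) (⟨⟩-congʳ (Vec.tail f) (v≈ ∘ suc))

  ⟨⟩-zeroʳ : ∀ {k} (f : Fin k → Carrier) → ⟨ f , (λ _ → 0#) ⟩ ≈ 0#
  ⟨⟩-zeroʳ {zero}  f = refl
  ⟨⟩-zeroʳ {suc k} f = trans (+-cong (zeroʳ _) (⟨⟩-zeroʳ (Vec.tail f))) (+-identityʳ 0#)

  ⟨⟩-linearʳ : ∀ {k} s (f u v : Fin k → Carrier) →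
    ⟨ f , (λ i → s * u i + v i) ⟩ ≈ s * ⟨ f , u ⟩ + ⟨ f , v ⟩
  ⟨⟩-linearʳ {zero}  s f u v = trans (sym (+-identityʳ 0#)) (+-congʳ (sym (zeroʳ s)))
  ⟨⟩-linearʳ {suc k} s f u v =
    trans (+-congˡ (⟨⟩-linearʳ s (Vec.tail f) (Vec.tail u) (Vec.tail v)))
          (step s (f zero) (u zero) (v zero) _ _)
    where
    step : ∀ s f₀ u₀ v₀ U V → f₀ * (s * u₀ + v₀) + (s * U + V) ≈ s * (f₀ * u₀ + U) + (f₀ * v₀ + V)
    step = solve 6 (λ s f₀ u₀ v₀ U V →
      f₀ :* (s :* u₀ :+ v₀) :+ (s :* U :+ V) := s :* (f₀ :* u₀ :+ U) :+ (f₀ :* v₀ :+ V)) refl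

  ⟨⟩-scaleˡ : ∀ {k} α (g v : Fin k → Carrier) → ⟨ (λ i → α * g i) , v ⟩ ≈ α * ⟨ g , v ⟩
  ⟨⟩-scaleˡ {zero}  α g v = sym (zeroʳ α)
  ⟨⟩-scaleˡ {suc k} α g v =
    trans (+-congˡ (⟨⟩-scaleˡ α (Vec.tail g) (Vec.tail v))) (step α (g zero) (v zero) _)
    where
    step : ∀ α g₀ v₀ G → α * g₀ * v₀ + α * G ≈ α * (g₀ * v₀ + G)
    step = solve 4 (λ α g₀ v₀ G → α :* g₀ :* v₀ :+ α :* G := α :* (g₀ :* v₀ :+ G)) refl

  unit : ∀ {k} → Fin k → Fin k → Carrier
  unit zero    zero    = 1#
  unit zero    (suc _) = 0#
  unit (suc i) zero    = 0#
  unit (suc i) (suc j) = unit i j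

  ⟨⟩-unitʳ : ∀ {k} (f : Fin k → Carrier) i → ⟨ f , unit i ⟩ ≈ f i
  ⟨⟩-unitʳ f zero    = trans (+-cong (*-identityʳ _) (⟨⟩-zeroʳ (Vec.tail f))) (+-identityʳ _)
  ⟨⟩-unitʳ f (suc i) = trans (+-cong (zeroʳ _) (⟨⟩-unitʳ (Vec.tail f) i)) (+-identityˡ _)

module LinearCombinations (F : Field) (m : ℕ) where
  open Field F hiding (zero)
  open PG F m
  open DotProduct F
  open ℤ-CoefficientRingSolver commRing using (solve; _:+_; _:*_; _:=_; :-_; :0; :1)

  lincomb-congˡ : ∀ {k} {c c′ : Fin k → Carrier} (b : Fin k → V) →
    (∀ i → c i ≈ c′ i) → lincomb c b ≈ᵥ lincomb c′ b
  lincomb-congˡ {zero}  _ _  _ = refl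
  lincomb-congˡ {suc k} b c≈ i = +-cong (*-congʳ (c≈ zero)) (lincomb-congˡ (b ∘ suc) (c≈ ∘ suc) i)

  lincomb-congʳ : ∀ {k} (c : Fin k → Carrier) {b b′ : Fin k → V} →
    (∀ j → b j ≈ᵥ b′ j) → lincomb c b ≈ᵥ lincomb c b′
  lincomb-congʳ {zero}  _ _  _ = refl
  lincomb-congʳ {suc k} c b≈ i = +-cong (*-congˡ (b≈ zero i)) (lincomb-congʳ (c ∘ suc) (b≈ ∘ suc) i)

  lincomb-zero : ∀ {k} (b : Fin k → V) → lincomb (λ _ → 0#) b ≈ᵥ 0ᵥ
  lincomb-zero {zero}  b i = refl
  lincomb-zero {suc k} b i = trans (+-cong (zeroˡ _) (lincomb-zero (b ∘ suc) i)) (+-identityʳ 0#)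

  lincomb-unit : ∀ {k} (b : Fin k → V) i → lincomb (unit i) b ≈ᵥ b i
  lincomb-unit b zero    j = trans (+-cong (*-identityˡ _) (lincomb-zero (b ∘ suc) j)) (+-identityʳ _)
  lincomb-unit b (suc i) j = trans (+-cong (zeroˡ _) (lincomb-unit (b ∘ suc) i j)) (+-identityˡ _)

  lincomb-linear : ∀ {k} s (x y : Fin k → Carrier) (b : Fin k → V) →
    lincomb (λ i → s * x i + y i) b ≈ᵥ ((s · lincomb x b) +ᵥ lincomb y b)
  lincomb-linear {zero}  s x y b i = trans (sym (+-identityʳ 0#)) (+-congʳ (sym (zeroʳ s)))
  lincomb-linear {suc k} s x y b i =
    trans (+-congˡ (lincomb-linear s (x ∘ suc) (y ∘ suc) (b ∘ suc) i))
          (step s (x zero) (y zero) (b zero i) _ _)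
    where
    step : ∀ s x₀ y₀ b₀ X Y → (s * x₀ + y₀) * b₀ + (s * X + Y) ≈ s * (x₀ * b₀ + X) + (y₀ * b₀ + Y)
    step = solve 6 (λ s x₀ y₀ b₀ X Y →
      (s :* x₀ :+ y₀) :* b₀ :+ (s :* X :+ Y) := s :* (x₀ :* b₀ :+ X) :+ (y₀ :* b₀ :+ Y)) refl

  lincomb-injective : ∀ {k} {w : Fin k → V} → LinIndep w → ∀ {a a′} →
    lincomb a w ≈ᵥ lincomb a′ w → ∀ i → a i ≈ a′ i
  lincomb-injective {w = w} w-indep {a} {a′} a≡a′ i =
    trans (difference (a i) (a′ i)) (trans (+-congʳ (w-indep d d≈0 i)) (+-identityˡ (a′ i)))
    where
    d : _ → Carrier
    d j = - 1# * a′ j + a j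
    d≈0 : lincomb d w ≈ᵥ 0ᵥ
    d≈0 j = trans (lincomb-linear (- 1#) a′ a w j)
      (trans (+-congʳ (*-congˡ (sym (a≡a′ j)))) (cancel _))
      where
      cancel : ∀ u → - 1# * u + u ≈ 0#
      cancel = solve 1 (λ u → :- :1 :* u :+ u := :0) refl
    difference : ∀ x y → x ≈ (- 1# * y + x) + y
    difference = solve 2 (λ x y → x := (:- :1 :* y :+ x) :+ y) refl

  ⟨⟩-lincomb : ∀ {k} (f : V) (γ : Fin k → Carrier) (w : Fin k → V) →
    ⟨ f , lincomb γ w ⟩ ≈ ⟨ γ , (λ i → ⟨ f , w i ⟩) ⟩
  ⟨⟩-lincomb {zero}  f γ w = ⟨⟩-zeroʳ f
  ⟨⟩-lincomb {suc k} f γ w =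
    trans (⟨⟩-linearʳ (γ zero) f (w zero) (lincomb (γ ∘ suc) (w ∘ suc)))
          (+-congˡ (⟨⟩-lincomb f (γ ∘ suc) (w ∘ suc)))

module Coordinates (F : Field) (n k : ℕ) where
  open Field F hiding (zero)
  open PG F n
  open LinearCombinations F n
  private module C = PG F k

  lincomb-lincomb : ∀ {l} (a : Fin l → Carrier) (μ : Fin l → C.V) (b : Fin (suc k) → V) →
    lincomb a (λ j → lincomb (μ j) b) ≈ᵥ lincomb (C.lincomb a μ) b
  lincomb-lincomb {zero}  a μ b i = sym (lincomb-zero b i)
  lincomb-lincomb {suc l} a μ b i =
    trans (+-congˡ (lincomb-lincomb (a ∘ suc) (μ ∘ suc) b i))
          (sym (lincomb-linear (a zero) (μ zero) (C.lincomb (a ∘ suc) (μ ∘ suc)) b i))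

  LinIndep⇒LinIndep-coordinates : ∀ {l} {w : Fin l → V} (μ : Fin l → C.V) (b : Fin (suc k) → V) →
    (∀ j → w j ≈ᵥ lincomb (μ j) b) → LinIndep w → C.LinIndep μ
  LinIndep⇒LinIndep-coordinates {w = w} μ b w≈ w-indep c c·μ≈0 = w-indep c λ i → begin
    lincomb c w i                        ≈⟨ lincomb-congʳ c w≈ i ⟩
    lincomb c (λ j → lincomb (μ j) b) i ≈⟨ lincomb-lincomb c μ b i ⟩
    lincomb (C.lincomb c μ) b i          ≈⟨ lincomb-congˡ b c·μ≈0 i ⟩
    lincomb (λ _ → 0#) b i               ≈⟨ lincomb-zero b i ⟩
    0#                                   ∎
    where open import Relation.Binary.Reasoning.Setoid setoid

  LinIndep-coordinates⇒LinIndep : ∀ {l} (μ : Fin l → C.V) (b : Fin (suc k) → V) →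
    LinIndep b → C.LinIndep μ → LinIndep (λ j → lincomb (μ j) b)
  LinIndep-coordinates⇒LinIndep μ b b-indep μ-indep c c·w≈0 =
    μ-indep c (b-indep (C.lincomb c μ) λ i → trans (sym (lincomb-lincomb c μ b i)) (c·w≈0 i))

module FiniteFieldLinearAlgebra {q : ℕ} (K : FiniteField q) where
  open FiniteField K hiding (zero)
  open import Data.List.Relation.Unary.Enumerates.Setoid setoid using (IsEnumeration)
  import Data.Vec.Functional.Relation.Binary.Pointwise.Properties as Pointwise

  elements : List Carrier
  elements = proj₁ size

  elements-length : length elements ≡ q
  elements-length = proj₁ (proj₂ size)

  elements-unique : AllPairs (λ a b → ¬ a ≈ b) elements
  elements-unique = proj₁ (proj₂ (proj₂ (proj₂ size)))

  elements-enumerate : IsEnumeration elements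
  elements-enumerate x = proj₂ (proj₂ (proj₂ (proj₂ size))) x tt

  _≟_ : ∀ x y → Dec (x ≈ y)
  x ≟ y = FiniteSetoid.≈-dec setoid elements-unique (elements-enumerate x) (elements-enumerate y)

  ≈-decSetoid : DecSetoid _ _
  ≈-decSetoid = record { isDecEquivalence = record { isEquivalence = isEquivalence ; _≟_ = _≟_ } }

  LinIndep⇒spanning : ∀ m (w : Fin (suc m) → PG.V fld m) → PG.LinIndep fld m w →
    ∀ v → ∃ λ a → PG._≈ᵥ_ fld m v (PG.lincomb fld m a w)
  LinIndep⇒spanning m w w-indep =
    FiniteDecSetoid.injective⇒surjective (Pointwise.decSetoid ≈-decSetoid (suc m))
      (VectorEnumeration.vectors-enumerates setoid elements-enumerate (suc m))
      (λ a → PG.lincomb fld m a w)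
      (LinearCombinations.lincomb-injective fld m {w = w} w-indep)

module Planes {q : ℕ} (K : FiniteField q) (n : ℕ) where
  open FiniteField K hiding (zero)
  open PG fld n
  open LinearCombinations fld n
  open Coordinates fld n 2
  open DotProduct fld using (unit)
  open FiniteFieldLinearAlgebra K using (LinIndep⇒spanning)
  private module F³ = PG fld 2

  ≅-sym : ∀ {π σ} → π ≅ σ → σ ≅ π
  ≅-sym π≅σ v = swap (π≅σ v)

  ≅-setoid : Setoid _ _
  ≅-setoid = record
    { Carrier = Plane ; _≈_ = _≅_
    ; isEquivalence = record
      { refl  = λ _ → id , id
      ; sym   = λ {π} {σ} → ≅-sym {π} {σ}
      ; trans = λ π≅σ σ≅ρ v → proj₁ (σ≅ρ v) ∘ proj₁ (π≅σ v) , proj₂ (π≅σ v) ∘ proj₂ (σ≅ρ v) } }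

  ∈ₚ-resp : ∀ {u v} π → u ≈ᵥ v → v ∈ₚ π → u ∈ₚ π
  ∈ₚ-resp π u≈v (c , v≈) = c , λ i → trans (u≈v i) (v≈ i)

  basis-∈ₚ : ∀ π i → Plane.basis π i ∈ₚ π
  basis-∈ₚ π i = unit i , λ j → sym (lincomb-unit (Plane.basis π) i j)

  lincomb-∈ₚ : ∀ {k} (a : Fin k → Carrier) (w : Fin k → V) σ → (∀ j → w j ∈ₚ σ) → lincomb a w ∈ₚ σ
  lincomb-∈ₚ a w σ w∈σ = F³.lincomb a μ , λ i →
    trans (lincomb-congʳ a (proj₂ ∘ w∈σ) i) (lincomb-lincomb a μ (Plane.basis σ) i)
    where
    μ = proj₁ ∘ w∈σ

  independent-⊆ : (w : Fin 3 → V) → LinIndep w → ∀ τ σ →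
    (∀ j → w j ∈ₚ τ) → (∀ j → w j ∈ₚ σ) → ∀ v → v ∈ₚ τ → v ∈ₚ σ
  independent-⊆ w w-indep τ σ w∈τ w∈σ v (c , v≈) =
    ∈ₚ-resp σ v≈a·w (lincomb-∈ₚ a w σ w∈σ)
    where
    μ = proj₁ ∘ w∈τ
    μ-indep = LinIndep⇒LinIndep-coordinates μ (Plane.basis τ) (proj₂ ∘ w∈τ) w-indep
    spanned = LinIndep⇒spanning 2 μ μ-indep c
    a = proj₁ spanned
    v≈a·w : v ≈ᵥ lincomb a w
    v≈a·w i = begin
      v i                                            ≈⟨ v≈ i ⟩
      lincomb c (Plane.basis τ) i                    ≈⟨ lincomb-congˡ (Plane.basis τ) (proj₂ spanned) i ⟩
      lincomb (F³.lincomb a μ) (Plane.basis τ) i     ≈⟨ lincomb-lincomb a μ (Plane.basis τ) i ⟨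
      lincomb a (λ j → lincomb (μ j) (Plane.basis τ)) i ≈⟨ lincomb-congʳ a (proj₂ ∘ w∈τ) i ⟨
      lincomb a w i                                  ∎
      where open import Relation.Binary.Reasoning.Setoid setoid

  independent-≅ : (w : Fin 3 → V) → LinIndep w → ∀ τ σ → (∀ j → w j ∈ₚ τ × w j ∈ₚ σ) → τ ≅ σ
  independent-≅ w w-indep τ σ w∈ v =
    independent-⊆ w w-indep τ σ (proj₁ ∘ w∈) (proj₂ ∘ w∈) v ,
    independent-⊆ w w-indep σ τ (proj₂ ∘ w∈) (proj₁ ∘ w∈) v

  sharedLine⇒MeetInLine : ∀ (l : Line) τ σ → l ⊆ₗ τ → l ⊆ₗ σ → ¬ τ ≅ σ → MeetInLine τ σ
  sharedLine⇒MeetInLine l τ σ l⊆τ l⊆σ τ≇σ =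
    (Line.basis l , Line.indep l , λ i → l⊆τ i , l⊆σ i) ,
    λ (w , w-indep , w∈) → τ≇σ (independent-≅ w w-indep τ σ w∈)

  MeetInLine⇒≇ : ∀ π τ → MeetInLine π τ → ¬ π ≅ τ
  MeetInLine⇒≇ π τ (_ , no-three) π≅τ =
    no-three (Plane.basis π , Plane.indep π , λ i → basis-∈ₚ π i , proj₁ (π≅τ _) (basis-∈ₚ π i))

module LineForms {q : ℕ} (K : FiniteField q) where
  open FiniteField K hiding (zero)
  open PG fld 2
  open DotProduct fld
  open LinearCombinations fld 2
  open FiniteFieldLinearAlgebra K using (LinIndep⇒spanning; _≟_; elements; elements-length; elements-enumerate)
  open ℤ-CoefficientRingSolver commRing using (solve; _:+_; _:*_; _:-_; :-_; _:=_; :0; :1)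
  open import Algebra.Properties.Ring ring using (-0#≈0#)

  ⟪_,_,_⟫ : Carrier → Carrier → Carrier → V
  ⟪ x , y , z ⟫ = x Vec.∷ y Vec.∷ z Vec.∷ Vec.[]

  -- The normalised nonzero linear forms on F³, one for each line of PG(2,q):
  -- form₀ a c is x₀ + a x₁ + c x₂, form₁ c is x₁ + c x₂ and form₂ is x₂.
  data LineForm : Set where
    form₀ : Carrier → Carrier → LineForm
    form₁ : Carrier → LineForm
    form₂ : LineForm

  coefficients : LineForm → V
  coefficients (form₀ a c) = ⟪ 1# , a , c ⟫
  coefficients (form₁ c)   = ⟪ 0# , 1# , c ⟫
  coefficients form₂       = ⟪ 0# , 0# , 1# ⟫

  kernel : LineForm → Fin 2 → V
  kernel (form₀ a c) = ⟪ - a , 1# , 0# ⟫ Vec.∷ ⟪ - c , 0# , 1# ⟫ Vec.∷ Vec.[]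
  kernel (form₁ c)   = ⟪ 1# , 0# , 0# ⟫ Vec.∷ ⟪ 0# , - c , 1# ⟫ Vec.∷ Vec.[]
  kernel form₂       = ⟪ 1# , 0# , 0# ⟫ Vec.∷ ⟪ 0# , 1# , 0# ⟫ Vec.∷ Vec.[]

  pivot : LineForm → Fin 3
  pivot (form₀ _ _) = zero
  pivot (form₁ _)   = suc zero
  pivot form₂       = suc (suc zero)

  Annihilates : LineForm → V → Set
  Annihilates f v = ⟨ coefficients f , v ⟩ ≈ 0#

  kernel-annihilated : ∀ f j → Annihilates f (kernel f j)
  kernel-annihilated (form₀ a c) zero       = solve 2 (λ a c → :1 :* :- a :+ (a :* :1 :+ (c :* :0 :+ :0)) := :0) refl a c
  kernel-annihilated (form₀ a c) (suc zero) = solve 2 (λ a c → :1 :* :- c :+ (a :* :0 :+ (c :* :1 :+ :0)) := :0) refl a c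
  kernel-annihilated (form₁ c)   zero       = solve 1 (λ c → :0 :* :1 :+ (:1 :* :0 :+ (c :* :0 :+ :0)) := :0) refl c
  kernel-annihilated (form₁ c)   (suc zero) = solve 1 (λ c → :0 :* :0 :+ (:1 :* :- c :+ (c :* :1 :+ :0)) := :0) refl c
  kernel-annihilated form₂       zero       = solve 0 (:0 :* :1 :+ (:0 :* :0 :+ (:1 :* :0 :+ :0)) := :0) refl
  kernel-annihilated form₂       (suc zero) = solve 0 (:0 :* :0 :+ (:0 :* :1 :+ (:1 :* :0 :+ :0)) := :0) refl

  private
    pick₀ : ∀ a b → a ≈ a * 1# + (b * 0# + 0#)
    pick₀ = solve 2 (λ a b → a := a :* :1 :+ (b :* :0 :+ :0)) refl
    pick₁ : ∀ a b → b ≈ a * 0# + (b * 1# + 0#)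
    pick₁ = solve 2 (λ a b → b := a :* :0 :+ (b :* :1 :+ :0)) refl

  kernel-independent : ∀ f → LinIndep (kernel f)
  kernel-independent (form₀ a c) α α·k≈0 zero       = trans (pick₀ _ _) (α·k≈0 (suc zero))
  kernel-independent (form₀ a c) α α·k≈0 (suc zero) = trans (pick₁ _ _) (α·k≈0 (suc (suc zero)))
  kernel-independent (form₁ c)   α α·k≈0 zero       = trans (pick₀ _ _) (α·k≈0 zero)
  kernel-independent (form₁ c)   α α·k≈0 (suc zero) = trans (pick₁ _ _) (α·k≈0 (suc (suc zero)))
  kernel-independent form₂       α α·k≈0 zero       = trans (pick₀ _ _) (α·k≈0 zero)
  kernel-independent form₂       α α·k≈0 (suc zero) = trans (pick₁ _ _) (α·k≈0 (suc zero))

  coefficient-pivot : ∀ f → coefficients f (pivot f) ≈ 1#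
  coefficient-pivot (form₀ _ _) = refl
  coefficient-pivot (form₁ _)   = refl
  coefficient-pivot form₂       = refl

  -- c together with the unit vector at the pivot of f is a basis of F³ in whose
  -- coordinates f reads off the last one, which thus vanishes on the kernel of f.
  kernel-⊆-span : ∀ f (c : Fin 2 → V) → LinIndep c → (∀ j → Annihilates f (c j)) →
    ∀ j → ∃ λ β → kernel f j ≈ᵥ lincomb β c
  kernel-⊆-span f c c-indep c-annihilated j =
    first-two γ , λ i → trans (kernel≈γ·w i) (drop-last γ γ₂≈0 i)
    where
    w : Fin 3 → V
    w = c zero Vec.∷ c (suc zero) Vec.∷ unit (pivot f) Vec.∷ Vec.[]

    first-two : (Fin 3 → Carrier) → Fin 2 → Carrier
    first-two γ = γ zero Vec.∷ γ (suc zero) Vec.∷ Vec.[]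

    f·w≈last : ∀ γ → ⟨ coefficients f , lincomb γ w ⟩ ≈ γ (suc (suc zero))
    f·w≈last γ = trans (⟨⟩-lincomb (coefficients f) γ w)
      (trans (⟨⟩-congʳ γ f·wᵢ) (⟨⟩-unitʳ γ (suc (suc zero))))
      where
      f·wᵢ : ∀ i → ⟨ coefficients f , w i ⟩ ≈ unit (suc (suc zero)) i
      f·wᵢ zero             = c-annihilated zero
      f·wᵢ (suc zero)       = c-annihilated (suc zero)
      f·wᵢ (suc (suc zero)) = trans (⟨⟩-unitʳ (coefficients f) (pivot f)) (coefficient-pivot f)

    drop-last : ∀ γ → γ (suc (suc zero)) ≈ 0# → lincomb γ w ≈ᵥ lincomb (first-two γ) c
    drop-last γ γ₂≈0 i = trans (+-congˡ (+-congˡ (+-congʳ (*-congʳ γ₂≈0))))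
      (solve 5 (λ a b x y z → a :* x :+ (b :* y :+ (:0 :* z :+ :0)) := a :* x :+ (b :* y :+ :0)) refl _ _ _ _ _)

    w-independent : LinIndep w
    w-independent γ γ·w≈0 = λ
      { zero             → first-two≈0 zero
      ; (suc zero)       → first-two≈0 (suc zero)
      ; (suc (suc zero)) → γ₂≈0 }
      where
      γ₂≈0 = trans (sym (f·w≈last γ)) (trans (⟨⟩-congʳ (coefficients f) γ·w≈0) (⟨⟩-zeroʳ (coefficients f)))
      first-two≈0 = c-indep (first-two γ) (λ i → trans (sym (drop-last γ γ₂≈0 i)) (γ·w≈0 i))

    γ = proj₁ (LinIndep⇒spanning 2 w w-independent (kernel f j))
    kernel≈γ·w = proj₂ (LinIndep⇒spanning 2 w w-independent (kernel f j))
    γ₂≈0 : γ (suc (suc zero)) ≈ 0#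
    γ₂≈0 = trans (sym (f·w≈last γ))
      (trans (⟨⟩-congʳ (coefficients f) (λ i → sym (kernel≈γ·w i))) (kernel-annihilated f j))

  minor : V → V → Fin 3 → Fin 3 → Carrier
  minor x y i k = x i * y k - x k * y i

  cross : V → V → V
  cross x y = ⟪ minor x y (suc zero) (suc (suc zero)) , minor x y (suc (suc zero)) zero , minor x y zero (suc zero) ⟫

  cross-annihilatesˡ : ∀ x y → ⟨ cross x y , x ⟩ ≈ 0#
  cross-annihilatesˡ x y = solve 6 (λ x₀ x₁ x₂ y₀ y₁ y₂ →
    (x₁ :* y₂ :- x₂ :* y₁) :* x₀ :+ ((x₂ :* y₀ :- x₀ :* y₂) :* x₁ :+ ((x₀ :* y₁ :- x₁ :* y₀) :* x₂ :+ :0)) := :0)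
    refl (x zero) (x (suc zero)) (x (suc (suc zero))) (y zero) (y (suc zero)) (y (suc (suc zero)))

  cross-annihilatesʳ : ∀ x y → ⟨ cross x y , y ⟩ ≈ 0#
  cross-annihilatesʳ x y = solve 6 (λ x₀ x₁ x₂ y₀ y₁ y₂ →
    (x₁ :* y₂ :- x₂ :* y₁) :* y₀ :+ ((x₂ :* y₀ :- x₀ :* y₂) :* y₁ :+ ((x₀ :* y₁ :- x₁ :* y₀) :* y₂ :+ :0)) := :0)
    refl (x zero) (x (suc zero)) (x (suc (suc zero))) (y zero) (y (suc zero)) (y (suc (suc zero)))

  private
    antisymmetric : ∀ x y i k → minor x y k i ≈ 0# → minor x y i k ≈ 0#
    antisymmetric x y i k mₖᵢ≈0 =
      trans (swap-minor (x i) (y k) (x k) (y i)) (trans (-‿cong mₖᵢ≈0) -0#≈0#)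
      where
      swap-minor : ∀ a b c d → a * b - c * d ≈ - (c * d - a * b)
      swap-minor = solve 4 (λ a b c d → a :* b :- c :* d := :- (c :* d :- a :* b)) refl

  cross≈0⇒minor≈0 : ∀ {x y} → cross x y ≈ᵥ 0ᵥ → ∀ i k → minor x y i k ≈ 0#
  cross≈0⇒minor≈0 {x} {y} x×y≈0 zero             zero             = -‿inverseʳ _
  cross≈0⇒minor≈0 {x} {y} x×y≈0 zero             (suc zero)       = x×y≈0 (suc (suc zero))
  cross≈0⇒minor≈0 {x} {y} x×y≈0 zero             (suc (suc zero)) = antisymmetric x y _ _ (x×y≈0 (suc zero))
  cross≈0⇒minor≈0 {x} {y} x×y≈0 (suc zero)       zero             = antisymmetric x y _ _ (x×y≈0 (suc (suc zero)))
  cross≈0⇒minor≈0 {x} {y} x×y≈0 (suc zero)       (suc zero)       = -‿inverseʳ _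
  cross≈0⇒minor≈0 {x} {y} x×y≈0 (suc zero)       (suc (suc zero)) = x×y≈0 zero
  cross≈0⇒minor≈0 {x} {y} x×y≈0 (suc (suc zero)) zero             = x×y≈0 (suc zero)
  cross≈0⇒minor≈0 {x} {y} x×y≈0 (suc (suc zero)) (suc zero)       = antisymmetric x y _ _ (x×y≈0 zero)
  cross≈0⇒minor≈0 {x} {y} x×y≈0 (suc (suc zero)) (suc (suc zero)) = -‿inverseʳ _

  independent⇒cross≉0 : (c : Fin 2 → V) → LinIndep c → ¬ cross (c zero) (c (suc zero)) ≈ᵥ 0ᵥ
  independent⇒cross≉0 c c-indep x×y≈0 =
    1≉0 (c-indep (unit zero) (λ k → trans (lincomb-unit c zero k) (x≈0 k)) zero)
    where
    x = c zero
    y = c (suc zero)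
    x≈0 : ∀ i → x i ≈ 0#
    x≈0 i = c-indep (- y i Vec.∷ x i Vec.∷ Vec.[])
      (λ k → trans (expand (x i) (y i) (x k) (y k)) (cross≈0⇒minor≈0 x×y≈0 i k)) (suc zero)
      where
      expand : ∀ xᵢ yᵢ xₖ yₖ → - yᵢ * xₖ + (xᵢ * yₖ + 0#) ≈ xᵢ * yₖ - xₖ * yᵢ
      expand = solve 4 (λ xᵢ yᵢ xₖ yₖ → :- yᵢ :* xₖ :+ (xᵢ :* yₖ :+ :0) := xᵢ :* yₖ :- xₖ :* yᵢ) refl

  private
    left-inverse : ∀ {x} → ¬ x ≈ 0# → ∃ λ α → 1# ≈ α * x
    left-inverse {x} x≉0 = let α , xα≈1 = inverse x x≉0 in α , trans (sym xα≈1) (*-comm x α)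

    scaled-zero : ∀ {α x} → x ≈ 0# → 0# ≈ α * x
    scaled-zero {α} x≈0 = sym (trans (*-congˡ x≈0) (zeroʳ α))

  nonzero⇒scaled-form : ∀ g → ¬ g ≈ᵥ 0ᵥ → ∃ λ f → ∃ λ α → coefficients f ≈ᵥ (α · g)
  nonzero⇒scaled-form g g≉0 with g zero ≟ 0# | g (suc zero) ≟ 0# | g (suc (suc zero)) ≟ 0#
  ... | no g₀≉0 | _ | _ =
    let α , 1≈αg₀ = left-inverse g₀≉0 in
    form₀ (α * g (suc zero)) (α * g (suc (suc zero))) , α ,
    λ { zero → 1≈αg₀ ; (suc zero) → refl ; (suc (suc zero)) → refl }
  ... | yes g₀≈0 | no g₁≉0 | _ =
    let α , 1≈αg₁ = left-inverse g₁≉0 in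
    form₁ (α * g (suc (suc zero))) , α ,
    λ { zero → scaled-zero g₀≈0 ; (suc zero) → 1≈αg₁ ; (suc (suc zero)) → refl }
  ... | yes g₀≈0 | yes g₁≈0 | no g₂≉0 =
    let α , 1≈αg₂ = left-inverse g₂≉0 in
    form₂ , α ,
    λ { zero → scaled-zero g₀≈0 ; (suc zero) → scaled-zero g₁≈0 ; (suc (suc zero)) → 1≈αg₂ }
  ... | yes g₀≈0 | yes g₁≈0 | yes g₂≈0 =
    ⊥-elim (g≉0 λ { zero → g₀≈0 ; (suc zero) → g₁≈0 ; (suc (suc zero)) → g₂≈0 })

  annihilator : (c : Fin 2 → V) → LinIndep c → ∃ λ f → ∀ j → Annihilates f (c j)
  annihilator c c-indep = f , λ j → begin
    ⟨ coefficients f , c j ⟩      ≈⟨ ⟨⟩-congˡ (c j) f≈αg ⟩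
    ⟨ α · g , c j ⟩               ≈⟨ ⟨⟩-scaleˡ α g (c j) ⟩
    α * ⟨ g , c j ⟩               ≈⟨ *-congˡ (g-annihilates j) ⟩
    α * 0#                        ≈⟨ zeroʳ α ⟩
    0#                            ∎
    where
    open import Relation.Binary.Reasoning.Setoid setoid
    g = cross (c zero) (c (suc zero))
    g-annihilates : ∀ j → ⟨ g , c j ⟩ ≈ 0#
    g-annihilates zero       = cross-annihilatesˡ (c zero) (c (suc zero))
    g-annihilates (suc zero) = cross-annihilatesʳ (c zero) (c (suc zero))
    scaled = nonzero⇒scaled-form g (independent⇒cross≉0 c c-indep)
    f = proj₁ scaled
    α = proj₁ (proj₂ scaled)
    f≈αg = proj₂ (proj₂ scaled)

  lineForms : List LineForm
  lineForms = concatMap (λ a → map (form₀ a) elements) elements ++ map form₁ elements ++ [ form₂ ]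

  length-lineForms : length lineForms ≡ q ℕ.* q ℕ.+ (q ℕ.+ 1)
  length-lineForms = begin
    length lineForms
      ≡⟨ length-++ form₀s ⟩
    length form₀s ℕ.+ length (map form₁ elements ++ [ form₂ ])
      ≡⟨ ≡.cong (length form₀s ℕ.+_) (length-++ (map form₁ elements)) ⟩
    length form₀s ℕ.+ (length (map form₁ elements) ℕ.+ 1)
      ≡⟨ ≡.cong₂ (λ k l → k ℕ.+ (l ℕ.+ 1)) length-form₀s (length-map form₁ elements) ⟩
    length elements ℕ.* q ℕ.+ (length elements ℕ.+ 1)
      ≡⟨ ≡.cong (λ k → k ℕ.* q ℕ.+ (k ℕ.+ 1)) elements-length ⟩
    q ℕ.* q ℕ.+ (q ℕ.+ 1)
      ∎
    where
    open ≡.≡-Reasoning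
    form₀s = concatMap (λ a → map (form₀ a) elements) elements
    length-form₀s : length form₀s ≡ length elements ℕ.* q
    length-form₀s = length-concatMap _ (λ a → ≡.trans (length-map (form₀ a) elements) elements-length) elements

  lineForms-complete : ∀ f → Any (λ f′ → coefficients f′ ≈ᵥ coefficients f) lineForms
  lineForms-complete (form₀ a c) = Anyₚ.++⁺ˡ (Anyₚ.concatMap⁺ _ (Any.map (λ a≈a′ → Anyₚ.map⁺
    (Any.map (λ c≈c′ → λ { zero → refl ; (suc zero) → sym a≈a′ ; (suc (suc zero)) → sym c≈c′ })
      (elements-enumerate c))) (elements-enumerate a)))
  lineForms-complete (form₁ c) = Anyₚ.++⁺ʳ (concatMap _ elements) (Anyₚ.++⁺ˡ (Anyₚ.map⁺
    (Any.map (λ c≈c′ → λ { zero → refl ; (suc zero) → refl ; (suc (suc zero)) → sym c≈c′ })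
      (elements-enumerate c))))
  lineForms-complete form₂ = Anyₚ.++⁺ʳ (concatMap _ elements) (Anyₚ.++⁺ʳ (map form₁ elements) (here λ _ → refl))

  annihilator∈lineForms : (c : Fin 2 → V) → LinIndep c → Any (λ f → ∀ j → Annihilates f (c j)) lineForms
  annihilator∈lineForms c c-indep =
    Any.map (λ f′≈f j → trans (⟨⟩-congˡ (c j) f′≈f) (f-annihilates j)) (lineForms-complete f)
    where
    f = proj₁ (annihilator c c-indep)
    f-annihilates = proj₂ (annihilator c c-indep)

module NeighbourCount {q : ℕ} (K : FiniteField q) (n : ℕ) where
  open FiniteField K hiding (zero)
  open PG fld n
  open LinearCombinations fld n
  open Coordinates fld n 2
  open Planes K n
  open LineForms K
    using (LineForm; Annihilates; kernel; kernel-independent; kernel-⊆-span; lineForms; length-lineForms; annihilator∈lineForms)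
  open FiniteSetoid ≅-setoid using (∈-─; Unique⇒length≤)
  open import Data.List.Membership.Setoid ≅-setoid using (_∈_; _─_)

  module _ (L : Plane → Set) (L-closed : IsPlaneSet L) (x : ℕ)
    (outside-meets : ∀ π → ¬ L π → HasSize _≅_ (λ σ → L σ × MeetInLine π σ) x)
    (π : Plane) (π∈L : L π) (π-lines : ∀ l → l ⊆ₗ π → ∃ λ σ → ¬ L σ × l ⊆ₗ σ) where

    lineOf : LineForm → Line
    lineOf f = record
      { basis = λ j → lincomb (kernel f j) (Plane.basis π)
      ; indep = LinIndep-coordinates⇒LinIndep (kernel f) (Plane.basis π) (Plane.indep π) (kernel-independent f) }

    lineOf⊆π : ∀ f → lineOf f ⊆ₗ π
    lineOf⊆π f j = kernel f j , λ _ → refl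

    σ : LineForm → Plane
    σ f = proj₁ (π-lines (lineOf f) (lineOf⊆π f))

    σ∉L : ∀ f → ¬ L (σ f)
    σ∉L f = proj₁ (proj₂ (π-lines (lineOf f) (lineOf⊆π f)))

    lineOf⊆σ : ∀ f → lineOf f ⊆ₗ σ f
    lineOf⊆σ f = proj₂ (proj₂ (π-lines (lineOf f) (lineOf⊆π f)))

    L-neighbours-of-σ : LineForm → List Plane
    L-neighbours-of-σ f = proj₁ (outside-meets (σ f) (σ∉L f))

    ∈-L-neighbours-of-σ : ∀ f τ → L τ → lineOf f ⊆ₗ τ → τ ∈ L-neighbours-of-σ f
    ∈-L-neighbours-of-σ f τ τ∈L lineOf⊆τ =
      proj₂ (proj₂ (proj₂ (proj₂ (outside-meets (σ f) (σ∉L f))))) τ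
        (τ∈L , sharedLine⇒MeetInLine (lineOf f) (σ f) τ (lineOf⊆σ f) lineOf⊆τ
                 (λ σ≅τ → σ∉L f (L-closed τ (σ f) (≅-sym {σ f} {τ} σ≅τ) τ∈L)))

    π∈L-neighbours-of-σ : ∀ f → π ∈ L-neighbours-of-σ f
    π∈L-neighbours-of-σ f = ∈-L-neighbours-of-σ f π π∈L (lineOf⊆π f)

    other-L-neighbours-of-σ : LineForm → List Plane
    other-L-neighbours-of-σ f = L-neighbours-of-σ f ─ π∈L-neighbours-of-σ f

    length-other-L-neighbours-of-σ : ∀ f → length (other-L-neighbours-of-σ f) ≡ x ∸ 1
    length-other-L-neighbours-of-σ f = ≡.cong (_∸ 1) (≡.trans
      (≡.sym (length-removeAt′ (L-neighbours-of-σ f) _))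
      (proj₁ (proj₂ (outside-meets (σ f) (σ∉L f)))))

    candidates : List Plane
    candidates = concatMap other-L-neighbours-of-σ lineForms

    L-neighbour∈candidates : ∀ τ → L τ → MeetInLine π τ → τ ∈ candidates
    L-neighbour∈candidates τ τ∈L π∩τ@((u , u-indep , u∈) , _) =
      Anyₚ.concatMap⁺ other-L-neighbours-of-σ (Any.map (λ {f} → τ∈others f) (annihilator∈lineForms μ μ-indep))
      where
      μ = λ j → proj₁ (proj₁ (u∈ j))
      u≈μ·b = λ j → proj₂ (proj₁ (u∈ j))
      μ-indep = LinIndep⇒LinIndep-coordinates μ (Plane.basis π) u≈μ·b u-indep

      lineOf⊆τ : ∀ f → (∀ j → Annihilates f (μ j)) → lineOf f ⊆ₗ τ
      lineOf⊆τ f μ-annihilated j = ∈ₚ-resp τ kernel·b≈β·u (lincomb-∈ₚ β u τ (proj₂ ∘ u∈))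
        where
        spanned = kernel-⊆-span f μ μ-indep μ-annihilated j
        β = proj₁ spanned
        kernel·b≈β·u : lincomb (kernel f j) (Plane.basis π) ≈ᵥ lincomb β u
        kernel·b≈β·u i = begin
          lincomb (kernel f j) (Plane.basis π) i                 ≈⟨ lincomb-congˡ (Plane.basis π) (proj₂ spanned) i ⟩
          lincomb (PG.lincomb fld 2 β μ) (Plane.basis π) i       ≈⟨ lincomb-lincomb β μ (Plane.basis π) i ⟨
          lincomb β (λ j → lincomb (μ j) (Plane.basis π)) i      ≈⟨ lincomb-congʳ β u≈μ·b i ⟨
          lincomb β u i                                          ∎
          where open import Relation.Binary.Reasoning.Setoid setoid

      τ∈others : ∀ f → (∀ j → Annihilates f (μ j)) → τ ∈ other-L-neighbours-of-σ f
      τ∈others f μ-annihilated =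
        ∈-─ {τ} {π} (π∈L-neighbours-of-σ f) (∈-L-neighbours-of-σ f τ τ∈L (lineOf⊆τ f μ-annihilated))
          (λ τ≅π → MeetInLine⇒≇ π τ π∩τ (≅-sym {τ} {π} τ≅π))

    L-neighbours-bound : ∀ k → HasSize _≅_ (λ τ → L τ × MeetInLine π τ) k →
      k ℕ.≤ (q ℕ.* q ℕ.+ (q ℕ.+ 1)) ℕ.* (x ∸ 1)
    L-neighbours-bound k (τs , τs-length , τs-neighbours , τs-unique , _) = begin
      k                   ≡⟨ τs-length ⟨
      length τs           ≤⟨ Unique⇒length≤ τs-unique τs⊆candidates ⟩
      length candidates   ≡⟨ length-concatMap other-L-neighbours-of-σ length-other-L-neighbours-of-σ lineForms ⟩
      length lineForms ℕ.* (x ∸ 1)                 ≡⟨ ≡.cong (ℕ._* (x ∸ 1)) length-lineForms ⟩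
      (q ℕ.* q ℕ.+ (q ℕ.+ 1)) ℕ.* (x ∸ 1)          ∎
      where
      open ≤-Reasoning
      τs⊆candidates = All.map (λ {τ} (τ∈L , π∩τ) → L-neighbour∈candidates τ τ∈L π∩τ) τs-neighbours

open import Data.Nat using (_*_; _+_; NonZero)
open import Data.Nat.Properties using (+-cancelˡ-≤)
open import Data.Nat.Tactic.RingSolver using (solve-∀)

counting-bound : ∀ l x q → 1 ≤ x → l + x ≤ (q * q + (q + 1)) * (x ∸ 1) → l + 1 ≤ (x ∸ 1) * (q * q + q)
counting-bound l (suc m) q _ l+x≤ =
  +-cancelˡ-≤ m (l + 1) (m * (q * q + q)) (≡.subst₂ _≤_ (left l m) (right m q) l+x≤)
  where
  left : ∀ l m → l + suc m ≡ m + (l + 1)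
  left = solve-∀
  right : ∀ m q → (q * q + (q + 1)) * m ≡ m + m * (q * q + q)
  right = solve-∀

lemma3p3 : (q : ℕ) → (K : FiniteField q) → (n : ℕ) → 5 ≤ n
    → .{{_ : NonZero (q ∸ 1)}}
    → let open PG (FiniteField.fld K) n in
      (L : Plane → Set) → IsPlaneSet L
    → (x : ℕ) → 1 ≤ x
    → (∀ π → ¬ L π → HasSize _≅_ (λ σ → L σ × MeetInLine π σ) x)
    → (∀ π → L π → HasSize _≅_ (λ σ → L σ × MeetInLine π σ) (λ₂ q n + x))
    → (∃ λ π → L π × (∀ (l : Line) → l ⊆ₗ π → ∃ λ σ → ¬ L σ × l ⊆ₗ σ))
    → λ₂ q n + 1 ≤ (x ∸ 1) * (q * q + q)
lemma3p3 q K n _ L L-closed x 1≤x outside-meets inside-meets (π , π∈L , π-lines) =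
  counting-bound (λ₂ q n) x q 1≤x
    (NeighbourCount.L-neighbours-bound K n L L-closed x outside-meets π π∈L π-lines
      (λ₂ q n + x) (inside-meets π π∈L))
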